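{- Let $E$ be an evident EFO branch. Then for every type $\sigma$ and every EFO term $s$ of type $\sigma$, $s\bowtie_\sigma s$.
   Context: Types are generated from countably many base types by: if $\sigma,\tau$ are types then $\sigma\tau$ is a type. One base type $o$ is fixed; the others are sorts ($\alpha$). Countably many names, each with a unique type, infinitely many of every type. Terms: names; $st$ of type $\mu$ for $s$ of type $\tau\mu$, $t$ of type $\tau$; $\lambda x.t$ of type $\sigma\tau$ for a name $x$ of type $\sigma$, $t$ of type $\tau$. $\Lambda_\sigma$ is the set of terms of type $\sigma$. Logical constants: $\neg:oo$, $\to:ooo$, $=_\sigma:\sigma\sigma o$ for every type $\sigma$, and $\forall_\alpha:(\alpha o)o$ for every sort $\alpha$; all other names are variables. The EFO constants are $\neg$, $\to$, $=_\alpha$ and $\forall_\alpha$ ($\alpha$ a sort). Formulas are terms of type $o$; $s=_\sigma t$ is $(=_\sigma)st$, $s\neq_\sigma t$ is $\neg(s=_\sigma t)$, $s\to t$ is $(\to)st$, $\forall_\alpha s$ is $(\forall_\alpha)s$. A term is EFO if the only logical constants occurring in it are EFO constants; $\mathrm{EFO}_\sigma$ is the set of EFO terms of type $\sigma$. A term is quasi-EFO if it is EFO or of the form $s\neq_\sigma t$ with $s,t$ EFO. A fixed normalization operator $s\mapsto[s]$ is a type-preserving total function on terms with (N1) $[[s]]=[s]$; (N2) $[[s]t]=[st]$; (N3) $[xs_1\dots s_n]=x[s_1]\dots[s_n]$ for a name $x$, $n\ge0$, $xs_1\dots s_n$ of base type. Substitutions $\theta$ (type-preserving partial maps from names to terms;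 $\theta^x_s$ updates $\theta$ at $x$) extend to type-preserving total maps $\hat\theta$ on terms with (S1) $\hat\theta x=\theta x$ if $x\in\mathrm{Dom}\,\theta$ else $x$; (S2) $\hat\theta(st)=(\hat\theta s)(\hat\theta t)$; (S3) $[(\hat\theta(\lambda x.s))t]=[\widehat{\theta^x_t}s]$; (S4) $[\hat\emptyset s]=[s]$. $s$ is normal if $[s]=s$. An EFO branch is a set of normal quasi-EFO formulas. For a branch $E$, a term $u\in\Lambda_\alpha$ is $\alpha$-discriminating in $E$ if $u\neq_\alpha t\in E$ or $t\neq_\alpha u\in E$ for some $t$. An EFO branch $E$ is evident if: (DN) $\neg\neg s\in E\Rightarrow s\in E$; (BQ) $s=_o t\in E\Rightarrow$ ($s,t\in E$ or $\neg s,\neg t\in E$); (BE) $s\neq_o t\in E\Rightarrow$ ($s,\neg t\in E$ or $\neg s,t\in E$); (FQ) $s=_{\sigma\tau}t\in E\Rightarrow [su]=[tu]\in E$ for all normal $u$ of type $\sigma$; (FE) $s\neq_{\sigma\tau}t\in E\Rightarrow [sx]\neq[tx]\in E$ for some variable $x$; (Mat) if $xs_1\dots s_n,\neg xt_1\dots t_n\in E$ ($x$ a variable, $n\ge0$) then $n\ge1$ and $s_i\neq t_i\in E$ for some $i$; (Dec) if $xs_1\dots s_n\neq_\alpha xt_1\dots t_n\in E$ ($x$ a variable) then $n\ge1$ and $s_i\neq t_i\in E$ for some $i$; (Con) if $s=_\alpha t,u\neq_\alpha v\in E$ then ($s\neq u,t\neq u\in E$) or ($s\neq v,t\neq v\in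 E$); (Imp) $s\to t\in E\Rightarrow\neg s\in E$ or $t\in E$; (ImpN) $\neg(s\to t)\in E\Rightarrow s,\neg t\in E$; (All) $\forall_\alpha s\in E\Rightarrow [su]\in E$ for every $\alpha$-discriminating $u$ in $E$; (All$'$) $\forall_\alpha s\in E\Rightarrow [su]\in E$ for some normal EFO term $u$ of type $\alpha$; (AllN) $\neg\forall_\alpha s\in E\Rightarrow\neg[sx]\in E$ for some variable $x$. Write $s\,\#\,t$ if $E$ contains $s\neq t$ or $t\neq s$. Compatibility relations $\bowtie_\sigma\subseteq\Lambda_\sigma\times\Lambda_\sigma$: $s\bowtie_o t$ iff $\{[s],\neg[t]\}\not\subseteq E$ and $\{\neg[s],[t]\}\not\subseteq E$; $s\bowtie_\alpha t$ iff not $[s]\,\#\,[t]$; $s\bowtie_{\sigma\tau}t$ iff $su\bowtie_\tau tv$ whenever $u\bowtie_\sigma v$. -}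

module Defs where

open import Data.Nat using (ℕ; _≟_)
open import Data.Bool using (Bool; true; false; if_then_else_)
open import Data.Nat using (_≡ᵇ_)
open import Data.Maybe using (Maybe; just; nothing; fromMaybe)
open import Data.Product using (Σ; _×_; _,_)
open import Data.Sum using (_⊎_)
open import Data.Unit using (⊤)
open import Data.Empty using (⊥)
open import Relation.Nullary using (¬_; Dec; yes; no)
open import Relation.Binary.PropositionalEquality using (_≡_; refl; cong; cong₂)

-- Types: base type o, countably many sorts (sort a), and function types.
-- (σ ⇒ τ) is the paper's στ.

data Ty : Set where
  o    : Ty
  sort : ℕ → Ty
  _⇒_  : Ty → Ty → Ty

infixr 20 _⇒_

IsBase : Ty → Set
IsBase o        = ⊤
IsBase (sort _) = ⊤
IsBase (_ ⇒ _)  = ⊥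

IsSort : Ty → Set
IsSort o        = ⊥
IsSort (sort _) = ⊤
IsSort (_ ⇒ _)  = ⊥

_≟Ty_ : (σ τ : Ty) → Dec (σ ≡ τ)
o ≟Ty o = yes refl
o ≟Ty sort _ = no (λ ())
o ≟Ty (_ ⇒ _) = no (λ ())
sort _ ≟Ty o = no (λ ())
sort a ≟Ty sort b with a ≟ b
... | yes refl = yes refl
... | no a≢b = no (λ { refl → a≢b refl })
sort _ ≟Ty (_ ⇒ _) = no (λ ())
(_ ⇒ _) ≟Ty o = no (λ ())
(_ ⇒ _) ≟Ty sort _ = no (λ ())
(σ ⇒ τ) ≟Ty (σ' ⇒ τ') with σ ≟Ty σ' | τ ≟Ty τ'
... | yes refl | yes refl = yes refl
... | no p | _ = no (λ { refl → p refl })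
... | yes _ | no q = no (λ { refl → q refl })

-- The logical constants are
-- neg (¬ : oo), imp (→ : ooo), eq σ (=σ : σσo) and all a (∀α : (αo)o);
-- every other name is a variable  var σ k  (infinitely many per type).

data Name : Ty → Set where
  neg : Name (o ⇒ o)
  imp : Name (o ⇒ o ⇒ o)
  eq  : (σ : Ty) → Name (σ ⇒ σ ⇒ o)
  all : (a : ℕ) → Name ((sort a ⇒ o) ⇒ o)
  var : (σ : Ty) → ℕ → Name σ

nameEq : ∀ {σ} → Name σ → Name σ → Bool
nameEq neg neg = true
nameEq imp imp = true
nameEq (eq _) (eq _) = true
nameEq (all _) (all _) = true
nameEq (var _ k) (var _ l) = k ≡ᵇ l
nameEq _ _ = false

data Tm : Ty → Set where
  nm  : ∀ {σ} → Name σ → Tm σ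
  app : ∀ {σ τ} → Tm (σ ⇒ τ) → Tm σ → Tm τ
  lam : ∀ {σ τ} → Name σ → Tm τ → Tm (σ ⇒ τ)

data Args : Ty → Ty → Set where
  []  : ∀ {ρ} → Args ρ ρ
  _∷_ : ∀ {σ τ ρ} → Tm σ → Args τ ρ → Args (σ ⇒ τ) ρ

infixr 5 _∷_

_·_ : ∀ {σ ρ} → Tm σ → Args σ ρ → Tm ρ
s · []       = s
s · (t ∷ ts) = app s t · ts

mapArgs : (∀ {τ} → Tm τ → Tm τ) → ∀ {σ ρ} → Args σ ρ → Args σ ρ
mapArgs f []       = []
mapArgs f (t ∷ ts) = f t ∷ mapArgs f ts

~_ : Tm o → Tm o
~ s = app (nm neg) s

_⊃_ : Tm o → Tm o → Tm o
s ⊃ t = app (app (nm imp) s) t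

_≐_ : ∀ {σ} → Tm σ → Tm σ → Tm o
_≐_ {σ} s t = app (app (nm (eq σ)) s) t

_≠ᶠ_ : ∀ {σ} → Tm σ → Tm σ → Tm o
s ≠ᶠ t = ~ (s ≐ t)

Π : (a : ℕ) → Tm (sort a ⇒ o) → Tm o
Π a s = app (nm (all a)) s

EFOName : ∀ {σ} → Name σ → Set
EFOName neg       = ⊤
EFOName imp       = ⊤
EFOName (eq σ)    = IsSort σ
EFOName (all _)   = ⊤
EFOName (var _ _) = ⊤

IsEFO : ∀ {σ} → Tm σ → Set
IsEFO (nm x)    = EFOName x
IsEFO (app s t) = IsEFO s × IsEFO t
IsEFO (lam x t) = EFOName x × IsEFO t

IsQuasiEFO : Tm o → Set
IsQuasiEFO u = IsEFO u ⊎
  Σ Ty (λ σ → Σ (Tm σ) (λ s → Σ (Tm σ) (λ t →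
    (u ≡ (s ≠ᶠ t)) × IsEFO s × IsEFO t)))

Subst : Set
Subst = ∀ {σ} → Name σ → Maybe (Tm σ)

∅ : Subst
∅ _ = nothing

upd : Subst → ∀ {σ} → Name σ → Tm σ → Subst
upd θ {σ} x t {τ} y with σ ≟Ty τ
... | yes refl = if nameEq x y then just t else θ y
... | no _     = θ y

record Normalization : Set where
  field
    nf  : ∀ {σ} → Tm σ → Tm σ
    hat : Subst → ∀ {σ} → Tm σ → Tm σ
    N1  : ∀ {σ} (s : Tm σ) → nf (nf s) ≡ nf s
    N2  : ∀ {σ τ} (s : Tm (σ ⇒ τ)) (t : Tm σ) → nf (app (nf s) t) ≡ nf (app s t)
    N3  : ∀ {σ ρ} (x : Name σ) (ss : Args σ ρ) → IsBase ρ →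
          nf (nm x · ss) ≡ nm x · mapArgs nf ss
    S1  : ∀ (θ : Subst) {σ} (x : Name σ) → hat θ (nm x) ≡ fromMaybe (nm x) (θ x)
    S2  : ∀ (θ : Subst) {σ τ} (s : Tm (σ ⇒ τ)) (t : Tm σ) →
          hat θ (app s t) ≡ app (hat θ s) (hat θ t)
    S3  : ∀ (θ : Subst) {σ τ} (x : Name σ) (s : Tm τ) (t : Tm σ) →
          nf (app (hat θ (lam x s)) t) ≡ nf (hat (upd θ x t) s)
    S4  : ∀ {σ} (s : Tm σ) → nf (hat ∅ s) ≡ nf s

Branch : Set₁
Branch = Tm o → Set

module _ (N : Normalization) (E : Branch) where
  open Normalization N

  Normal : ∀ {σ} → Tm σ → Set
  Normal s = nf s ≡ s

  EFOBranch : Set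
  EFOBranch = ∀ (s : Tm o) → E s → Normal s × IsQuasiEFO s

  _#_ : ∀ {σ} → Tm σ → Tm σ → Set
  s # t = E (s ≠ᶠ t) ⊎ E (t ≠ᶠ s)

  Discriminating : ∀ {a} → Tm (sort a) → Set
  Discriminating {a} u = Σ (Tm (sort a)) (λ t → E (u ≠ᶠ t) ⊎ E (t ≠ᶠ u))

  SomeDiff : ∀ {σ ρ} → Args σ ρ → Args σ ρ → Set
  SomeDiff (s ∷ ss) (t ∷ ts) = E (s ≠ᶠ t) ⊎ SomeDiff ss ts
  SomeDiff _ _ = ⊥

  record Evident : Set where
    field
      DN   : ∀ s → E (~ (~ s)) → E s
      BQ   : ∀ (s t : Tm o) → E (s ≐ t) → (E s × E t) ⊎ (E (~ s) × E (~ t))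
      BE   : ∀ (s t : Tm o) → E (s ≠ᶠ t) → (E s × E (~ t)) ⊎ (E (~ s) × E t)
      FQ   : ∀ {σ τ} (s t : Tm (σ ⇒ τ)) → E (s ≐ t) →
             ∀ (u : Tm σ) → Normal u → E (nf (app s u) ≐ nf (app t u))
      FE   : ∀ {σ τ} (s t : Tm (σ ⇒ τ)) → E (s ≠ᶠ t) →
             Σ ℕ (λ k → E (nf (app s (nm (var σ k))) ≠ᶠ nf (app t (nm (var σ k)))))
      Mat  : ∀ {σ} (k : ℕ) (ss ts : Args σ o) →
             E (nm (var σ k) · ss) → E (~ (nm (var σ k) · ts)) → SomeDiff ss ts
      Dec' : ∀ {σ} (a k : ℕ) (ss ts : Args σ (sort a)) →
             E ((nm (var σ k) · ss) ≠ᶠ (nm (var σ k) · ts)) → SomeDiff ss ts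
      Con  : ∀ {a} (s t u v : Tm (sort a)) → E (s ≐ t) → E (u ≠ᶠ v) →
             (E (s ≠ᶠ u) × E (t ≠ᶠ u)) ⊎ (E (s ≠ᶠ v) × E (t ≠ᶠ v))
      Imp  : ∀ s t → E (s ⊃ t) → E (~ s) ⊎ E t
      ImpN : ∀ s t → E (~ (s ⊃ t)) → E s × E (~ t)
      All  : ∀ a (s : Tm (sort a ⇒ o)) → E (Π a s) →
             ∀ (u : Tm (sort a)) → Discriminating u → E (nf (app s u))
      All′ : ∀ a (s : Tm (sort a ⇒ o)) → E (Π a s) →
             Σ (Tm (sort a)) (λ u → Normal u × IsEFO u × E (nf (app s u)))
      AllN : ∀ a (s : Tm (sort a ⇒ o)) → E (~ (Π a s)) →
             Σ ℕ (λ k → E (~ (nf (app s (nm (var (sort a) k))))))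

  Compat : (σ : Ty) → Tm σ → Tm σ → Set
  Compat o s t        = ¬ (E (nf s) × E (~ (nf t))) × ¬ (E (~ (nf s)) × E (nf t))
  Compat (sort _) s t = ¬ (nf s # nf t)
  Compat (σ ⇒ τ) s t  = ∀ (u v : Tm σ) → Compat σ u v → Compat τ (app s u) (app t v)

-- Proof idea: a logical-relations argument.  Compatibility is symmetric
-- and depends only on normal forms.  A variable applied to pointwise
-- undiscriminated spines is self-compatible by (Mat) and (Dec); this is
-- proved together with the fact that compatible terms are never asserted
-- different, which (FE) and (BE) reduce to the base types.  Each EFO
-- constant is self-compatible: ¬ by (DN), → by (Imp)/(ImpN), =α by (Con),
-- ∀α by (All)/(All′)/(AllN).  Induction on terms then shows that
-- compatible substitutions send an EFO term to compatible terms, and the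
-- empty substitution gives the theorem.
module Submission where

import Defs
open Defs hiding (_#_)
open import Data.Nat using (ℕ)
open import Data.Bool using (true; false)
open import Data.Product using (Σ; _×_; _,_; proj₁; swap)
open import Data.Sum using (inj₁; inj₂)
open import Data.Unit using (tt)
open import Relation.Nullary using (¬_; yes; no)
open import Relation.Nullary.Decidable.Core using (¬¬-excluded-middle)
open import Relation.Binary.PropositionalEquality

_∷ʳ_ : ∀ {ρ σ τ} → Args ρ (σ ⇒ τ) → Tm σ → Args ρ τ
[]       ∷ʳ u = u ∷ []
(s ∷ ss) ∷ʳ u = s ∷ (ss ∷ʳ u)

·-∷ʳ : ∀ {ρ σ τ} (h : Tm ρ) (ss : Args ρ (σ ⇒ τ)) (u : Tm σ) →
       app (h · ss) u ≡ h · (ss ∷ʳ u)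
·-∷ʳ h []       u = refl
·-∷ʳ h (s ∷ ss) u = ·-∷ʳ (app h s) ss u

module _ (N : Normalization) where
  open Normalization N

  nf-app-cong : ∀ {σ τ} {s s′ : Tm (σ ⇒ τ)} (u : Tm σ) →
                nf s ≡ nf s′ → nf (app s u) ≡ nf (app s′ u)
  nf-app-cong {s = s} {s′} u e = begin
    nf (app s u)        ≡⟨ N2 s u ⟨
    nf (app (nf s) u)   ≡⟨ cong (λ z → nf (app z u)) e ⟩
    nf (app (nf s′) u)  ≡⟨ N2 s′ u ⟩
    nf (app s′ u)       ∎
    where open ≡-Reasoning

  nf-app₁ : ∀ {σ} (x : Name (σ ⇒ o)) (u : Tm σ) →
            nf (app (nm x) u) ≡ app (nm x) (nf u)
  nf-app₁ x u = N3 x (u ∷ []) tt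

  nf-app₂ : ∀ {σ τ} (x : Name (σ ⇒ τ ⇒ o)) (u : Tm σ) (v : Tm τ) →
            nf (app (app (nm x) u) v) ≡ app (app (nm x) (nf u)) (nf v)
  nf-app₂ x u v = N3 x (u ∷ v ∷ []) tt

module Compatibility (N : Normalization) (E : Branch) where
  open Normalization N

  _#_ : ∀ {σ} → Tm σ → Tm σ → Set
  _#_ = Defs._#_ N E

  _⋈_ : ∀ {σ} → Tm σ → Tm σ → Set
  _⋈_ {σ} = Compat N E σ

  Clash : Tm o → Tm o → Set
  Clash s t = E (nf s) × E (~ nf t)

  #-sym : ∀ {σ} {s t : Tm σ} → s # t → t # s
  #-sym (inj₁ e) = inj₂ e
  #-sym (inj₂ e) = inj₁ e

  ⋈ₒ-intro : {s t : Tm o} → ¬ Clash s t → ¬ Clash t s → s ⋈ t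
  ⋈ₒ-intro ¬st ¬ts = ¬st , λ c → ¬ts (swap c)

  Clash-resp-nf : {s t s′ t′ : Tm o} → nf s ≡ nf s′ → nf t ≡ nf t′ → Clash s t → Clash s′ t′
  Clash-resp-nf e e′ (p , q) = subst E e p , subst (λ z → E (~ z)) e′ q

  ⋈-resp-nf : ∀ σ {s t s′ t′ : Tm σ} → nf s ≡ nf s′ → nf t ≡ nf t′ → s ⋈ t → s′ ⋈ t′
  ⋈-resp-nf o e e′ (¬st , ¬ts) =
    ⋈ₒ-intro (λ c → ¬st (Clash-resp-nf (sym e) (sym e′) c))
             (λ c → ¬ts (swap (Clash-resp-nf (sym e′) (sym e) c)))
  ⋈-resp-nf (sort _) e e′ h c = h (subst₂ _#_ (sym e) (sym e′) c)
  ⋈-resp-nf (σ ⇒ τ) e e′ h u v uv =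
    ⋈-resp-nf τ (nf-app-cong N u e) (nf-app-cong N v e′) (h u v uv)

  ⋈-sym : ∀ σ {s t : Tm σ} → s ⋈ t → t ⋈ s
  ⋈-sym o (¬st , ¬ts)   = ⋈ₒ-intro (λ c → ¬ts (swap c)) ¬st
  ⋈-sym (sort _) h c    = h (#-sym c)
  ⋈-sym (σ ⇒ τ) h u v uv = ⋈-sym τ (h v u (⋈-sym σ uv))

  data Undiscriminated : ∀ {ρ σ} → Args ρ σ → Args ρ σ → Set where
    []  : ∀ {ρ} → Undiscriminated {ρ} [] []
    _∷_ : ∀ {σ τ ρ} {s t : Tm σ} {ss ts : Args τ ρ} →
          ¬ (nf s # nf t) → Undiscriminated ss ts → Undiscriminated (s ∷ ss) (t ∷ ts)

  Undiscriminated-sym : ∀ {ρ σ} {ss ts : Args ρ σ} →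
                        Undiscriminated ss ts → Undiscriminated ts ss
  Undiscriminated-sym []       = []
  Undiscriminated-sym (h ∷ hs) = (λ c → h (#-sym c)) ∷ Undiscriminated-sym hs

  Undiscriminated-∷ʳ : ∀ {ρ σ τ} {ss ts : Args ρ (σ ⇒ τ)} {u v : Tm σ} →
                       Undiscriminated ss ts → ¬ (nf u # nf v) →
                       Undiscriminated (ss ∷ʳ u) (ts ∷ʳ v)
  Undiscriminated-∷ʳ []       h = h ∷ []
  Undiscriminated-∷ʳ (h′ ∷ hs) h = h′ ∷ Undiscriminated-∷ʳ hs h

  Undiscriminated⇒¬SomeDiff : ∀ {ρ σ} {ss ts : Args ρ σ} → Undiscriminated ss ts →
                              ¬ SomeDiff N E (mapArgs nf ss) (mapArgs nf ts)
  Undiscriminated⇒¬SomeDiff []       ()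
  Undiscriminated⇒¬SomeDiff (h ∷ hs) (inj₁ e) = h (inj₁ e)
  Undiscriminated⇒¬SomeDiff (h ∷ hs) (inj₂ d) = Undiscriminated⇒¬SomeDiff hs d

module _ (N : Normalization) (E : Branch) (ev : Evident N E) where
  open Normalization N
  open Evident ev
  open Compatibility N E

  x⟨_⟩ : ∀ {σ} → ℕ → Tm σ
  x⟨_⟩ {σ} k = nm (var σ k)

  var-spine-¬Clash : ∀ {ρ} (k : ℕ) {ss ts : Args ρ o} → Undiscriminated ss ts →
                     ¬ Clash (x⟨ k ⟩ · ss) (x⟨ k ⟩ · ts)
  var-spine-¬Clash {ρ} k {ss} {ts} hs (p , q) =
    Undiscriminated⇒¬SomeDiff hs
      (Mat k _ _ (subst E (N3 (var ρ k) ss tt) p) (subst (λ z → E (~ z)) (N3 (var ρ k) ts tt) q))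

  var-spine-¬≠ : ∀ {ρ a} (k : ℕ) {ss ts : Args ρ (sort a)} → Undiscriminated ss ts →
                 ¬ E (nf (x⟨ k ⟩ · ss) ≠ᶠ nf (x⟨ k ⟩ · ts))
  var-spine-¬≠ {ρ} {a} k {ss} {ts} hs e =
    Undiscriminated⇒¬SomeDiff hs
      (Dec' a k _ _ (subst₂ (λ p q → E (p ≠ᶠ q)) (N3 (var ρ k) ss tt) (N3 (var ρ k) ts tt) e))

  mutual
    ⋈⇒¬≠ : ∀ σ {s t : Tm σ} → s ⋈ t → ¬ E (nf s ≠ᶠ nf t)
    ⋈⇒¬≠ o (¬st , ¬ts) e with BE _ _ e
    ... | inj₁ c = ¬st c
    ... | inj₂ c = ¬ts c
    ⋈⇒¬≠ (sort _) h e = h (inj₁ e)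
    ⋈⇒¬≠ (σ ⇒ τ) {s} {t} h e with FE (nf s) (nf t) e
    ... | k , e′ = ⋈⇒¬≠ τ (h x⟨ k ⟩ x⟨ k ⟩ (var-⋈ σ k))
                     (subst₂ (λ a b → E (a ≠ᶠ b)) (N2 s x⟨ k ⟩) (N2 t x⟨ k ⟩) e′)

    ⋈⇒¬# : ∀ σ {s t : Tm σ} → s ⋈ t → ¬ (nf s # nf t)
    ⋈⇒¬# σ h (inj₁ e) = ⋈⇒¬≠ σ h e
    ⋈⇒¬# σ h (inj₂ e) = ⋈⇒¬≠ σ (⋈-sym σ h) e

    var-spine-⋈ : ∀ σ {ρ} (k : ℕ) {ss ts : Args ρ σ} → Undiscriminated ss ts →
                  (x⟨ k ⟩ · ss) ⋈ (x⟨ k ⟩ · ts)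
    var-spine-⋈ o k hs =
      ⋈ₒ-intro (var-spine-¬Clash k hs) (var-spine-¬Clash k (Undiscriminated-sym hs))
    var-spine-⋈ (sort _) k hs (inj₁ e) = var-spine-¬≠ k hs e
    var-spine-⋈ (sort _) k hs (inj₂ e) = var-spine-¬≠ k (Undiscriminated-sym hs) e
    var-spine-⋈ (σ ⇒ τ) k {ss} {ts} hs u v uv =
      subst₂ _⋈_ (sym (·-∷ʳ x⟨ k ⟩ ss u)) (sym (·-∷ʳ x⟨ k ⟩ ts v))
        (var-spine-⋈ τ k (Undiscriminated-∷ʳ hs (⋈⇒¬# σ uv)))

    var-⋈ : ∀ σ (k : ℕ) → x⟨ k ⟩ ⋈ x⟨ k ⟩
    var-⋈ σ k = var-spine-⋈ σ k []

  #-var⇒Discriminating : ∀ {a} (w : Tm (sort a)) (k : ℕ) →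
                         w # nf x⟨ k ⟩ → Discriminating N E x⟨ k ⟩
  #-var⇒Discriminating {a} w k c with subst (w #_) (N3 (var (sort a) k) [] tt) c
  ... | inj₁ e = w , inj₂ e
  ... | inj₂ e = w , inj₁ e

  -- Whether x⟨ k ⟩ is discriminating cannot be decided, but a double
  -- negation suffices because every use of this lemma proves a negation.
  Π-instance-⋈-var : ∀ a {s : Tm (sort a ⇒ o)} → E (Π a s) → (k : ℕ) →
                     ¬ ¬ Σ (Tm (sort a)) λ w → E (nf (app s w)) × w ⋈ x⟨ k ⟩
  Π-instance-⋈-var a {s} e k ¬inst = ¬¬-excluded-middle λ where
    (yes disc) → ¬inst (x⟨ k ⟩ , All a s e x⟨ k ⟩ disc , var-⋈ (sort a) k)
    (no ¬disc) → let (w , _ , _ , ew) = All′ a s e in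
      ¬inst (w , ew , λ c → ¬disc (#-var⇒Discriminating (nf w) k c))

  ~-¬Clash : {u v : Tm o} → u ⋈ v → ¬ Clash (~ u) (~ v)
  ~-¬Clash {u} {v} (_ , ¬ts) (p , q) =
    ¬ts (subst E (nf-app₁ N neg u) p , DN _ (subst (λ z → E (~ z)) (nf-app₁ N neg v) q))

  ⊃-¬Clash : {u u′ v v′ : Tm o} → u ⋈ u′ → v ⋈ v′ → ¬ Clash (u ⊃ v) (u′ ⊃ v′)
  ⊃-¬Clash {u} {u′} {v} {v′} (_ , ¬uu′) (¬vv′ , _) (p , q)
    with ImpN _ _ (subst (λ z → E (~ z)) (nf-app₂ N imp u′ v′) q)
       | Imp _ _ (subst E (nf-app₂ N imp u v) p)
  ... | (pu′ , qv′) | inj₁ qu = ¬uu′ (qu , pu′)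
  ... | (pu′ , qv′) | inj₂ pv = ¬vv′ (pv , qv′)

  ≐-¬Clash : ∀ {a} {u u′ v v′ : Tm (sort a)} → u ⋈ u′ → v ⋈ v′ → ¬ Clash (u ≐ v) (u′ ≐ v′)
  ≐-¬Clash {a} {u} {u′} {v} {v′} uu′ vv′ (p , q)
    with Con _ _ _ _ (subst E (nf-app₂ N (eq (sort a)) u v) p)
                     (subst (λ z → E (~ z)) (nf-app₂ N (eq (sort a)) u′ v′) q)
  ... | inj₁ (u≠u′ , _) = uu′ (inj₁ u≠u′)
  ... | inj₂ (_ , v≠v′) = vv′ (inj₁ v≠v′)

  Π-¬Clash : ∀ a {u v : Tm (sort a ⇒ o)} → u ⋈ v → ¬ Clash (Π a u) (Π a v)
  Π-¬Clash a {u} {v} uv (p , q)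
    with AllN a (nf v) (subst (λ z → E (~ z)) (nf-app₁ N (all a) v) q)
  ... | k , q′ = Π-instance-⋈-var a (subst E (nf-app₁ N (all a) u) p) k λ (w , p′ , c) →
    proj₁ (uv w x⟨ k ⟩ c) (subst E (N2 u w) p′ , subst (λ z → E (~ z)) (N2 v x⟨ k ⟩) q′)

  EFOName-⋈ : ∀ {σ} (x : Name σ) → EFOName x → nm x ⋈ nm x
  EFOName-⋈ neg _ u v uv =
    ⋈ₒ-intro (~-¬Clash uv) (~-¬Clash (⋈-sym o uv))
  EFOName-⋈ imp _ u u′ uu′ v v′ vv′ =
    ⋈ₒ-intro (⊃-¬Clash uu′ vv′) (⊃-¬Clash (⋈-sym o uu′) (⋈-sym o vv′))
  EFOName-⋈ (eq (sort a)) _ u u′ uu′ v v′ vv′ =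
    ⋈ₒ-intro (≐-¬Clash uu′ vv′) (≐-¬Clash (⋈-sym (sort a) uu′) (⋈-sym (sort a) vv′))
  EFOName-⋈ (all a) _ u v uv =
    ⋈ₒ-intro (Π-¬Clash a uv) (Π-¬Clash a (⋈-sym (sort a ⇒ o) uv))
  EFOName-⋈ (var σ k) _ = var-⋈ σ k

  _⋈ₛ_ : Subst → Subst → Set
  θ ⋈ₛ θ′ = ∀ {τ} (y : Name τ) → EFOName y → hat θ (nm y) ⋈ hat θ′ (nm y)

  upd-⋈ₛ : ∀ {θ θ′ : Subst} → θ ⋈ₛ θ′ → ∀ {σ} (x : Name σ) {u v : Tm σ} → u ⋈ v →
           upd θ x u ⋈ₛ upd θ′ x v
  upd-⋈ₛ {θ} {θ′} h {σ} x {u} {v} uv {τ} y ey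
    rewrite S1 (upd θ x u) y | S1 (upd θ′ x v) y with σ ≟Ty τ
  ... | no _ = subst₂ _⋈_ (S1 θ y) (S1 θ′ y) (h y ey)
  ... | yes refl with nameEq x y
  ...   | true  = uv
  ...   | false = subst₂ _⋈_ (S1 θ y) (S1 θ′ y) (h y ey)

  ∅-⋈ₛ : ∅ ⋈ₛ ∅
  ∅-⋈ₛ y ey rewrite S1 ∅ y = EFOName-⋈ y ey

  hat-⋈ : ∀ {σ} {θ θ′ : Subst} → θ ⋈ₛ θ′ → (s : Tm σ) → IsEFO s → hat θ s ⋈ hat θ′ s
  hat-⋈ h (nm y) ey = h y ey
  hat-⋈ {θ = θ} {θ′} h (app s t) (es , et) =
    subst₂ _⋈_ (sym (S2 θ s t)) (sym (S2 θ′ s t)) (hat-⋈ h s es _ _ (hat-⋈ h t et))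
  hat-⋈ {θ = θ} {θ′} h (lam x s) (_ , es) u v uv =
    ⋈-resp-nf _ (sym (S3 θ x s u)) (sym (S3 θ′ x s v)) (hat-⋈ (upd-⋈ₛ h x uv) s es)

  EFO-⋈-refl : ∀ {σ} (s : Tm σ) → IsEFO s → s ⋈ s
  EFO-⋈-refl s es = ⋈-resp-nf _ (S4 s) (S4 s) (hat-⋈ ∅-⋈ₛ s es)

lemma12p4 : (N : Normalization) (E : Branch) → EFOBranch N E → Evident N E →
    ∀ (σ : Ty) (s : Tm σ) → IsEFO s → Compat N E σ s s
lemma12p4 N E _ ev σ = EFO-⋈-refl N E ev
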